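{- Let $A=(a_{ij})\in\mathbb{R}^{[m]\times[n]}$. If $A$ has a forbidden pattern, then $A$ does not have an elimination ordering.
   Context: Write $[k]=\{1,\dots,k\}$. A pair $(I,J)$ with $I\subseteq[m]$, $J\subseteq[n]$, $|I|=|J|=\lambda\neq 0$, is a forbidden pattern in $A$ if there are orderings $I=\{i_1,\dots,i_\lambda\}$, $J=\{j_1,\dots,j_\lambda\}$ such that, with $i_{\lambda+1}:=i_1$, for every $\ell\in[\lambda]$: $a_{ij_\ell}=0$ for all $i\in I\setminus\{i_\ell,i_{\ell+1}\}$, and $a_{i_\ell j_\ell}a_{i_{\ell+1}j_\ell}<0$. For a real matrix $B$ with row index set $[m]$ and column index set $C$, $B$ can be eliminated at column $j\in C$ if at least one holds: (i) for all rows $i$, if $b_{ij}>0$ then $b_{ij'}=0$ for all $j'\in C\setminus\{j\}$; (ii) for all rows $i$, if $b_{ij}<0$ then $b_{ij'}=0$ for all $j'\in C\setminus\{j\}$. For $J'\subseteq[n]$, $\mathrm{elm}(A,J')$ is the submatrix of $A$ with column index set $[n]\setminus J'$. A sequence $(j_1,\dots,j_n)$ of the integers in $[n]$ is an elimination ordering of $A$ if for every $t\in[n]$, $\mathrm{elm}(A,\{j_1,\dots,j_{t-1}\})$ can be eliminated at column $j_t$. -}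

module Defs where

open import Level using (Level; _⊔_) renaming (suc to lsuc)
open import Algebra.Bundles using (CommutativeRing)
open import Relation.Binary.Core using (Rel)
open import Relation.Binary.Structures using (IsStrictTotalOrder)
open import Relation.Binary.PropositionalEquality using (_≡_; _≢_)
open import Relation.Nullary using (¬_)
open import Data.Nat using (ℕ; suc)
open import Data.Nat.DivMod using (_%_; m%n<n)
open import Data.Fin using (Fin; toℕ; fromℕ<) renaming (_<_ to _<ᶠ_)
open import Data.Product using (Σ; ∃; _×_)
open import Data.Sum using (_⊎_)
open import Function.Definitions using (Injective; Bijective)

-- The statement only
-- uses the ring operations, zero and the strict order, so we state it for an
-- arbitrary (totally) ordered commutative ring; ℝ is an instance.
record OrderedCommutativeRing (c ℓ ℓ< : Level) : Set (lsuc (c ⊔ ℓ ⊔ ℓ<)) where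
  field
    commutativeRing : CommutativeRing c ℓ
  open CommutativeRing commutativeRing public
  field
    _<_                 : Rel Carrier ℓ<
    <-isStrictTotalOrder : IsStrictTotalOrder _≈_ _<_
    +-monoˡ-<           : ∀ {x y} z → x < y → (x + z) < (y + z)
    *-pos               : ∀ {x y} → 0# < x → 0# < y → 0# < (x * y)

module _ {c ℓ ℓ<} (R : OrderedCommutativeRing c ℓ ℓ<) where
  open OrderedCommutativeRing R

  Matrix : ℕ → ℕ → Set c
  Matrix m n = Fin m → Fin n → Carrier

  -- cyclic successor on Fin λ (so that i_{λ+1} := i_1)
  next : ∀ {k} → Fin (suc k) → Fin (suc k)
  next {k} l = fromℕ< (m%n<n (suc (toℕ l)) (suc k))

  -- (I , J) with |I| = |J| = λ = suc k ≠ 0, given by the orderings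
  -- i_1,…,i_λ and j_1,…,j_λ (injective enumerations of I and J).
  IsForbiddenPattern : ∀ {m n k} → Matrix m n →
                       (Fin (suc k) → Fin m) → (Fin (suc k) → Fin n) → Set (ℓ ⊔ ℓ<)
  IsForbiddenPattern A is js =
    Injective _≡_ _≡_ is × Injective _≡_ _≡_ js ×
    (∀ l →
      (∀ l′ → is l′ ≢ is l → is l′ ≢ is (next l) → A (is l′) (js l) ≈ 0#) ×
      ((A (is l) (js l) * A (is (next l)) (js l)) < 0#))

  HasForbiddenPattern : ∀ {m n} → Matrix m n → Set (ℓ ⊔ ℓ<)
  HasForbiddenPattern {m} {n} A =
    Σ ℕ λ k → Σ (Fin (suc k) → Fin m) λ is → Σ (Fin (suc k) → Fin n) λ js →
      IsForbiddenPattern A is js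

  -- The submatrix of A with column index set C (C given as a predicate on [n])
  -- can be eliminated at column j ∈ C.
  CanEliminateAt : ∀ {m n} → Matrix m n → (Fin n → Set) → Fin n → Set (ℓ ⊔ ℓ<)
  CanEliminateAt {m} {n} A C j =
    (∀ (i : Fin m) → 0# < A i j → ∀ j′ → C j′ → j′ ≢ j → A i j′ ≈ 0#) ⊎
    (∀ (i : Fin m) → A i j < 0# → ∀ j′ → C j′ → j′ ≢ j → A i j′ ≈ 0#)

  elmCols : ∀ {n} → (Fin n → Set) → (Fin n → Set)
  elmCols J′ j = ¬ J′ j

  IsEliminationOrdering : ∀ {m n} → Matrix m n → (Fin n → Fin n) → Set (ℓ ⊔ ℓ<)
  IsEliminationOrdering {m} {n} A σ =
    Bijective _≡_ _≡_ σ ×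
    (∀ t → CanEliminateAt A (elmCols (λ j → ∃ λ s → s <ᶠ t × σ s ≡ j)) (σ t))

  HasEliminationOrdering : ∀ {m n} → Matrix m n → Set (ℓ ⊔ ℓ<)
  HasEliminationOrdering {m} {n} A = ∃ λ (σ : Fin n → Fin n) → IsEliminationOrdering A σ

{-# OPTIONS --safe #-}
-- Let t be the first step of an elimination ordering that removes a column
-- j_l of the pattern, so every column of J is still present at step t.
-- Column j_l has entries of opposite signs in rows i_l and i_{l+1}, and each
-- of these rows has a further nonzero entry inside J (in columns j_{l-1} and
-- j_{l+1}), so neither (i) nor (ii) holds at j_l.  For λ = 1 the pattern
-- would force a_{i_1 j_1}² < 0.
module Submission where

open import Defs
open import Data.Nat using (ℕ)
open import Relation.Nullary using (¬_)

open import Data.Nat.Base using (zero; suc; s≤s)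
open import Data.Nat.DivMod using (_%_; n%n≡0; m<n⇒m%n≡m)
open import Data.Fin.Base using (Fin; zero; suc; toℕ; fromℕ; fromℕ<; inject₁; inject)
  renaming (_<_ to _<ᶠ_)
open import Data.Fin.Properties
  using (toℕ-injective; toℕ-fromℕ<; toℕ-fromℕ; toℕ-inject₁; toℕ-inject; toℕ<n;
         <⇒≢; 0≢1+n; ≤̄⇒inject₁<; ≤-refl; ¬∀⟶∃¬-smallest; any?; _≟_)
open import Data.Fin.Relation.Unary.Top using (view; ‵fromℕ; ‵inject₁)
open import Data.Product using (∃; _×_; _,_; proj₂; map₂)
open import Data.Sum using (_⊎_; inj₁; inj₂)
open import Function.Base using (_∘_)
open import Function.Definitions using (Surjective)
open import Relation.Binary.Definitions using (tri<; tri≈; tri>)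
open import Relation.Binary.PropositionalEquality
  using (_≡_; _≢_; refl; sym; trans; cong; subst; module ≡-Reasoning)
open import Relation.Binary.Structures using (IsStrictTotalOrder)
open import Relation.Nullary.Decidable using (¬?; decidable-stable)
open import Relation.Nullary.Negation using (contradiction)
open import Relation.Unary using (Pred; Decidable)
import Algebra.Properties.Ring as RingProperties
import Relation.Binary.Reasoning.Setoid as ≈-Reasoning

∃⟶∃-smallest : ∀ {n p} {P : Pred (Fin n) p} → Decidable P →
               ∃ P → ∃ λ i → P i × (∀ {j} → j <ᶠ i → ¬ P j)
∃⟶∃-smallest {n} {P = P} P? (i , Pi)
  with ¬∀⟶∃¬-smallest n (¬_ ∘ P) (¬? ∘ P?) (λ ∀¬P → ∀¬P i Pi)
... | i′ , ¬¬Pi′ , below =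
  i′ , decidable-stable (P? i′) ¬¬Pi′ ,
  λ j<i′ Pj → below (fromℕ< j<i′) (subst P (sym (inject-fromℕ< j<i′)) Pj)
  where
  inject-fromℕ< : ∀ {j} (j<i′ : j <ᶠ i′) → inject {i = i′} (fromℕ< j<i′) ≡ j
  inject-fromℕ< j<i′ = toℕ-injective (trans (toℕ-inject _) (toℕ-fromℕ< j<i′))

firstStepInImage : ∀ {m n k} {σ : Fin m → Fin n} → Surjective _≡_ _≡_ σ → (js : Fin (suc k) → Fin n) →
                   ∃ λ t → (∃ λ l → σ t ≡ js l) × (∀ {s} → s <ᶠ t → ¬ ∃ λ l → σ s ≡ js l)
firstStepInImage {σ = σ} σ-surjective js =
  ∃⟶∃-smallest (λ t → any? (λ l → σ t ≟ js l))
               (map₂ (λ σ≡js0 → zero , σ≡js0 refl) (σ-surjective (js zero)))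

module OrderedCommutativeRingProperties {c ℓ ℓ<} (R : OrderedCommutativeRing c ℓ ℓ<) where
  open OrderedCommutativeRing R renaming (trans to ≈-trans)
  open IsStrictTotalOrder <-isStrictTotalOrder using (compare; irrefl; asym; <-respˡ-≈; <-respʳ-≈)
  open RingProperties ring using (-‿distribˡ-*; -‿distribʳ-*; -‿involutive)

  OppositeSigns : Carrier → Carrier → Set ℓ<
  OppositeSigns x y = (0# < x × y < 0#) ⊎ (x < 0# × 0# < y)

  x<0⇒0<-x : ∀ {x} → x < 0# → 0# < (- x)
  x<0⇒0<-x {x} x<0 =
    <-respʳ-≈ (+-identityˡ (- x)) (<-respˡ-≈ (-‿inverseʳ x) (+-monoˡ-< (- x) x<0))

  *-neg : ∀ {x y} → x < 0# → y < 0# → 0# < (x * y)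
  *-neg {x} {y} x<0 y<0 = <-respʳ-≈ -x*-y≈x*y (*-pos (x<0⇒0<-x x<0) (x<0⇒0<-x y<0))
    where
    -x*-y≈x*y : - x * - y ≈ x * y
    -x*-y≈x*y = begin
      - x * - y     ≈⟨ -‿distribˡ-* x (- y) ⟨
      - (x * - y)   ≈⟨ -‿cong (-‿distribʳ-* x y) ⟨
      - (- (x * y)) ≈⟨ -‿involutive (x * y) ⟩
      x * y         ∎
      where open ≈-Reasoning setoid

  x≈0⇒x*y≈0 : ∀ {x} y → x ≈ 0# → x * y ≈ 0#
  x≈0⇒x*y≈0 y x≈0 = ≈-trans (*-congʳ x≈0) (zeroˡ y)

  y≈0⇒x*y≈0 : ∀ x {y} → y ≈ 0# → x * y ≈ 0#
  y≈0⇒x*y≈0 x y≈0 = ≈-trans (*-congˡ y≈0) (zeroʳ x)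

  x*y<0⇒x≉0 : ∀ {x y} → (x * y) < 0# → ¬ (x ≈ 0#)
  x*y<0⇒x≉0 {y = y} xy<0 x≈0 = irrefl (x≈0⇒x*y≈0 y x≈0) xy<0

  x*y<0⇒y≉0 : ∀ {x y} → (x * y) < 0# → ¬ (y ≈ 0#)
  x*y<0⇒y≉0 {x} xy<0 y≈0 = irrefl (y≈0⇒x*y≈0 x y≈0) xy<0

  x*y<0⇒oppositeSigns : ∀ {x y} → (x * y) < 0# → OppositeSigns x y
  x*y<0⇒oppositeSigns {x} {y} xy<0 with compare x 0# | compare y 0#
  ... | tri≈ _ x≈0 _ | _            = contradiction x≈0 (x*y<0⇒x≉0 xy<0)
  ... | _            | tri≈ _ y≈0 _ = contradiction y≈0 (x*y<0⇒y≉0 xy<0)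
  ... | tri< x<0 _ _ | tri< y<0 _ _ = contradiction (*-neg x<0 y<0) (asym xy<0)
  ... | tri< x<0 _ _ | tri> _ _ 0<y = inj₂ (x<0 , 0<y)
  ... | tri> _ _ 0<x | tri< y<0 _ _ = inj₁ (0<x , y<0)
  ... | tri> _ _ 0<x | tri> _ _ 0<y = contradiction (*-pos 0<x 0<y) (asym xy<0)

  x*x≮0 : ∀ x → ¬ ((x * x) < 0#)
  x*x≮0 x xx<0 with x*y<0⇒oppositeSigns xx<0
  ... | inj₁ (0<x , x<0) = asym 0<x x<0
  ... | inj₂ (x<0 , 0<x) = asym x<0 0<x

module _ {c ℓ ℓ<} (R : OrderedCommutativeRing c ℓ ℓ<) where
  open OrderedCommutativeRing R using (_≈_; _*_; _<_; 0#)
  open OrderedCommutativeRingProperties R using (OppositeSigns; x*y<0⇒oppositeSigns; x*y<0⇒x≉0; x*y<0⇒y≉0)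

  next-fromℕ : ∀ k → next R (fromℕ k) ≡ zero
  next-fromℕ k = toℕ-injective (begin
    toℕ (next R (fromℕ k))     ≡⟨ toℕ-fromℕ< _ ⟩
    suc (toℕ (fromℕ k)) % suc k ≡⟨ cong (λ x → suc x % suc k) (toℕ-fromℕ k) ⟩
    suc k % suc k               ≡⟨ n%n≡0 (suc k) ⟩
    0                           ∎)
    where open ≡-Reasoning

  next-inject₁ : ∀ {k} (q : Fin k) → next R (inject₁ q) ≡ suc q
  next-inject₁ {k} q = toℕ-injective (begin
    toℕ (next R (inject₁ q))      ≡⟨ toℕ-fromℕ< _ ⟩
    suc (toℕ (inject₁ q)) % suc k ≡⟨ cong (λ x → suc x % suc k) (toℕ-inject₁ q) ⟩
    suc (toℕ q) % suc k           ≡⟨ m<n⇒m%n≡m (s≤s (toℕ<n q)) ⟩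
    suc (toℕ q)                   ∎)
    where open ≡-Reasoning

  prev : ∀ {k} → Fin (suc k) → Fin (suc k)
  prev zero    = fromℕ _
  prev (suc q) = inject₁ q

  next-prev : ∀ {k} (l : Fin (suc k)) → next R (prev l) ≡ l
  next-prev zero    = next-fromℕ _
  next-prev (suc q) = next-inject₁ q

  next≢ : ∀ {k} (l : Fin (suc (suc k))) → next R l ≢ l
  next≢ {k} l with view l
  ... | ‵fromℕ     = 0≢1+n ∘ trans (sym (next-fromℕ (suc k)))
  ... | ‵inject₁ q = <⇒≢ (≤̄⇒inject₁< ≤-refl) ∘ sym ∘ trans (sym (next-inject₁ q))

  prev≢ : ∀ {k} (l : Fin (suc (suc k))) → prev l ≢ l
  prev≢ l prev-l≡l = next≢ l (trans (cong (next R) (sym prev-l≡l)) (next-prev l))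

  module _ {m n} (A : Matrix R m n) (C : Fin n → Set) where

    NonzeroOffColumn : Fin m → Fin n → Set ℓ
    NonzeroOffColumn i j = ∃ λ j′ → C j′ × j′ ≢ j × ¬ (A i j′ ≈ 0#)

    nonzeroOffColumn⇒¬zeroOffColumn : ∀ {i j} →
      NonzeroOffColumn i j → ¬ (∀ j′ → C j′ → j′ ≢ j → A i j′ ≈ 0#)
    nonzeroOffColumn⇒¬zeroOffColumn (j′ , j′∈C , j′≢j , Aij′≉0) zeroOff =
      Aij′≉0 (zeroOff j′ j′∈C j′≢j)

    oppositeSigns⇒¬CanEliminateAt : ∀ {i i′ j} → OppositeSigns (A i j) (A i′ j) →
      NonzeroOffColumn i j → NonzeroOffColumn i′ j → ¬ CanEliminateAt R A C j
    oppositeSigns⇒¬CanEliminateAt {i = i} (inj₁ (0<x , _)) nz _ (inj₁ pos) =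
      nonzeroOffColumn⇒¬zeroOffColumn nz (pos i 0<x)
    oppositeSigns⇒¬CanEliminateAt {i′ = i′} (inj₁ (_ , y<0)) _ nz′ (inj₂ neg) =
      nonzeroOffColumn⇒¬zeroOffColumn nz′ (neg i′ y<0)
    oppositeSigns⇒¬CanEliminateAt {i′ = i′} (inj₂ (_ , 0<y)) _ nz′ (inj₁ pos) =
      nonzeroOffColumn⇒¬zeroOffColumn nz′ (pos i′ 0<y)
    oppositeSigns⇒¬CanEliminateAt {i = i} (inj₂ (x<0 , _)) nz _ (inj₂ neg) =
      nonzeroOffColumn⇒¬zeroOffColumn nz (neg i x<0)

  forbiddenPattern⇒¬CanEliminateAt : ∀ {m n k} {A : Matrix R m n}
    {is : Fin (suc (suc k)) → Fin m} {js : Fin (suc (suc k)) → Fin n} →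
    IsForbiddenPattern R A is js → ∀ {C} → (∀ l → C (js l)) → ∀ l → ¬ CanEliminateAt R A C (js l)
  forbiddenPattern⇒¬CanEliminateAt {A = A} {is} {js} (_ , js-injective , cycle) {C} J⊆C l =
    oppositeSigns⇒¬CanEliminateAt A C (x*y<0⇒oppositeSigns (sign l))
      (js (prev l) , J⊆C (prev l) , prev≢ l ∘ js-injective ,
       subst (λ l′ → ¬ (A (is l′) (js (prev l)) ≈ 0#)) (next-prev l) (x*y<0⇒y≉0 (sign (prev l))))
      (js (next R l) , J⊆C (next R l) , next≢ l ∘ js-injective , x*y<0⇒x≉0 (sign (next R l)))
    where
    sign : ∀ l → (A (is l) (js l) * A (is (next R l)) (js l)) < 0#
    sign l = proj₂ (cycle l)

open OrderedCommutativeRingProperties using (x*x≮0)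

lemma3 : ∀ {c ℓ ℓ<} (R : OrderedCommutativeRing c ℓ ℓ<) {m n : ℕ} (A : Matrix R m n) →
         HasForbiddenPattern R A → ¬ HasEliminationOrdering R A
-- When λ = 1, next R zero computes to zero.
lemma3 R A (zero , _ , _ , _ , _ , cycle) _ = x*x≮0 R _ (proj₂ (cycle zero))
lemma3 R A (suc _ , _ , js , forbidden) (σ , (_ , σ-surjective) , eliminable)
  with firstStepInImage σ-surjective js
... | t , (l , σt≡jsl) , earlier =
  forbiddenPattern⇒¬CanEliminateAt R forbidden J-remains l
    (subst (CanEliminateAt R A _) σt≡jsl (eliminable t))
  where
  J-remains : ∀ p → ¬ ∃ λ s → s <ᶠ t × σ s ≡ js p
  J-remains p (s , s<t , σs≡jsp) = earlier s<t (p , σs≡jsp)
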